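{- In a square-increasing IRL $\mathbf{A}$ the following are equivalent: (i) $f^2=f$; (ii) $f\leqslant e$; (iii) $\mathbf{A}$ is idempotent. Consequently, a square-increasing IRL that is not idempotent has no idempotent subalgebra (and in particular no trivial subalgebra).
   Context: An involutive (commutative) residuated lattice (IRL) is an algebra $\langle A;\cdot,\wedge,\vee,\neg,e\rangle$ such that $\langle A;\cdot,e\rangle$ is a commutative monoid, $\langle A;\wedge,\vee\rangle$ is a lattice with order $\leqslant$, $\neg\neg x=x$, and $x\cdot y\leqslant z\iff \neg z\cdot y\leqslant\neg x$. Write $f:=\neg e$, $x^2:=x\cdot x$. It is square-increasing if $x\leqslant x^2$ for all $x$, and idempotent if $x^2=x$ for all $x$. Subalgebras are in the full signature $\cdot,\wedge,\vee,\neg,e$. -}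

module Defs where

open import Level using (Level; suc; _⊔_)
open import Relation.Binary.PropositionalEquality using (_≡_)
open import Data.Product using (_×_; Σ; ∃)
open import Function.Bundles using (_⇔_)

-- An involutive commutative residuated lattice ⟨A; ·, ∧, ∨, ¬, e⟩,
-- with equality taken to be propositional equality on the carrier.
record IRL (a : Level) : Set (suc a) where
  infixl 7 _·_
  infixr 6 _∧_
  infixr 5 _∨_
  infix 8 ¬_
  infix 4 _≤_
  infix 9 _²
  field
    Carrier : Set a
    _·_ : Carrier → Carrier → Carrier
    _∧_ : Carrier → Carrier → Carrier
    _∨_ : Carrier → Carrier → Carrier
    ¬_  : Carrier → Carrier
    e   : Carrier
    ·-assoc : ∀ x y z → (x · y) · z ≡ x · (y · z)
    ·-comm  : ∀ x y → x · y ≡ y · x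
    ·-identityˡ : ∀ x → e · x ≡ x
    ∧-comm  : ∀ x y → x ∧ y ≡ y ∧ x
    ∨-comm  : ∀ x y → x ∨ y ≡ y ∨ x
    ∧-assoc : ∀ x y z → (x ∧ y) ∧ z ≡ x ∧ (y ∧ z)
    ∨-assoc : ∀ x y z → (x ∨ y) ∨ z ≡ x ∨ (y ∨ z)
    ∧-absorbs-∨ : ∀ x y → x ∧ (x ∨ y) ≡ x
    ∨-absorbs-∧ : ∀ x y → x ∨ (x ∧ y) ≡ x
  _≤_ : Carrier → Carrier → Set a
  x ≤ y = x ∧ y ≡ x
  field
    ¬¬-involutive : ∀ x → ¬ (¬ x) ≡ x
    residuation : ∀ x y z → (x · y ≤ z) ⇔ (¬ z · y ≤ ¬ x)

  f : Carrier
  f = ¬ e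

  _² : Carrier → Carrier
  x ² = x · x

module _ {a : Level} (A : IRL a) where
  open IRL A

  SquareIncreasing : Set a
  SquareIncreasing = ∀ x → x ≤ x ²

  Idempotent : Set a
  Idempotent = ∀ x → x ² ≡ x

  record Subalgebra (ℓ : Level) : Set (a ⊔ suc ℓ) where
    field
      member : Carrier → Set ℓ
      e-closed : member e
      ·-closed : ∀ {x y} → member x → member y → member (x · y)
      ∧-closed : ∀ {x y} → member x → member y → member (x ∧ y)
      ∨-closed : ∀ {x y} → member x → member y → member (x ∨ y)
      ¬-closed : ∀ {x} → member x → member (¬ x)

  IdempotentSub : ∀ {ℓ} → Subalgebra ℓ → Set (a ⊔ ℓ)
  IdempotentSub S = ∀ x → Subalgebra.member S x → x ² ≡ x

  TrivialSub : ∀ {ℓ} → Subalgebra ℓ → Set (a ⊔ ℓ)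
  TrivialSub S = ∀ x y → Subalgebra.member S x → Subalgebra.member S y → x ≡ y

module Submission where

-- Write ∼ for the involution and f = ∼ e.  In every IRL the
-- residuation law specialised to z = f reads  x · y ≤ f ⇔ y ≤ ∼ x
-- (because ∼ f = e); together with the lattice order and monotonicity of ·
-- this gives two facts that need no extra hypothesis:
--   * f · f ≤ f  implies  f ≤ ∼ f = e            ((i) ⇒ (ii));
--   * if f ≤ e then (∼x)² · x² = (∼x · x)² ≤ f · f ≤ f, i.e. x² ≤ ∼((∼x)²).
-- In a square-increasing IRL, ∼x ≤ (∼x)² gives ∼((∼x)²) ≤ x, so x ≤ x² ≤ x
-- and the algebra is idempotent ((ii) ⇒ (iii)); (iii) ⇒ (i) is immediate.
-- Finally every subalgebra contains e and f = ∼ e, so an idempotent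
-- subalgebra forces f² = f, and a trivial one forces f = e, hence f ≤ e;
-- either way the whole algebra is idempotent.

open import Defs
open import Level using (Level)
open import Relation.Binary.PropositionalEquality
  using (_≡_; refl; sym; trans; cong; subst; isEquivalence; module ≡-Reasoning)
open import Relation.Binary.Bundles using (Poset)
open import Relation.Nullary using (¬_)
open import Data.Product using (_×_; _,_)
open import Function.Bundles using (_⇔_; mk⇔; Equivalence)
import Relation.Binary.Reasoning.PartialOrder as PosetReasoning

module IRLProperties {a : Level} (A : IRL a) where
  open IRL A renaming (¬_ to ∼_)
  open Equivalence using (to; from)

  ∧-idem : ∀ x → x ∧ x ≡ x
  ∧-idem x = trans (cong (x ∧_) (sym (∨-absorbs-∧ x x))) (∧-absorbs-∨ x (x ∧ x))

  ≤-reflexive : ∀ {x y} → x ≡ y → x ≤ y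
  ≤-reflexive {x} refl = ∧-idem x

  ≤-refl : ∀ {x} → x ≤ x
  ≤-refl = ≤-reflexive refl

  ≤-trans : ∀ {x y z} → x ≤ y → y ≤ z → x ≤ z
  ≤-trans {x} {y} {z} x≤y y≤z = begin
    x ∧ z        ≡⟨ cong (_∧ z) (sym x≤y) ⟩
    (x ∧ y) ∧ z  ≡⟨ ∧-assoc x y z ⟩
    x ∧ (y ∧ z)  ≡⟨ cong (x ∧_) y≤z ⟩
    x ∧ y        ≡⟨ x≤y ⟩
    x            ∎
    where open ≡-Reasoning

  ≤-antisym : ∀ {x y} → x ≤ y → y ≤ x → x ≡ y
  ≤-antisym {x} {y} x≤y y≤x = trans (sym x≤y) (trans (∧-comm x y) y≤x)

  ²-distrib-· : ∀ x y → x ² · y ² ≡ (x · y) ²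
  ²-distrib-· x y = begin
    (x · x) · (y · y)  ≡⟨ ·-assoc x x (y · y) ⟩
    x · (x · (y · y))  ≡⟨ cong (x ·_) (·-assoc x y y) ⟨
    x · ((x · y) · y)  ≡⟨ cong (λ t → x · (t · y)) (·-comm x y) ⟩
    x · ((y · x) · y)  ≡⟨ cong (x ·_) (·-assoc y x y) ⟩
    x · (y · (x · y))  ≡⟨ ·-assoc x y (x · y) ⟨
    (x · y) · (x · y)  ∎
    where open ≡-Reasoning

  ≤-poset : Poset a a a
  ≤-poset = record
    { _≈_ = _≡_
    ; _≤_ = _≤_
    ; isPartialOrder = record
      { isPreorder = record
        { isEquivalence = isEquivalence
        ; reflexive = ≤-reflexive
        ; trans = ≤-trans
        }
      ; antisym = ≤-antisym
      }
    }

  open PosetReasoning ≤-poset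

  ·-identityʳ : ∀ x → x · e ≡ x
  ·-identityʳ x = trans (·-comm x e) (·-identityˡ x)

  ∼f≡e : ∼ f ≡ e
  ∼f≡e = ¬¬-involutive e

  -- Residuation with y = e: the involution reverses the order.
  ∼-antitone : ∀ {x y} → x ≤ y → ∼ y ≤ ∼ x
  ∼-antitone {x} {y} x≤y = begin
    ∼ y      ≡⟨ ·-identityʳ (∼ y) ⟨
    ∼ y · e  ≤⟨ to (residuation x e y) (begin x · e ≡⟨ ·-identityʳ x ⟩ x ≤⟨ x≤y ⟩ y ∎) ⟩
    ∼ x      ∎

  -- Multiplication is monotone: residuate y · z ≤ y · z and use ∼ y ≤ ∼ x.
  ·-monoˡ : ∀ {x y} z → x ≤ y → x · z ≤ y · z
  ·-monoˡ {x} {y} z x≤y = from (residuation x z (y · z)) (begin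
    ∼ (y · z) · z  ≤⟨ to (residuation y z (y · z)) ≤-refl ⟩
    ∼ y            ≤⟨ ∼-antitone x≤y ⟩
    ∼ x            ∎)

  ·-mono : ∀ {x x′ y y′} → x ≤ x′ → y ≤ y′ → x · y ≤ x′ · y′
  ·-mono {x} {x′} {y} {y′} x≤x′ y≤y′ = begin
    x · y    ≤⟨ ·-monoˡ y x≤x′ ⟩
    x′ · y   ≡⟨ ·-comm x′ y ⟩
    y · x′   ≤⟨ ·-monoˡ x′ y≤y′ ⟩
    y′ · x′  ≡⟨ ·-comm y′ x′ ⟩
    x′ · y′  ∎

  -- The residuation law at z = f: x and y are "orthogonal" iff y ≤ ∼ x.
  ·≤f⇔≤∼ : ∀ x y → (x · y ≤ f) ⇔ (y ≤ ∼ x)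
  ·≤f⇔≤∼ x y = mk⇔
    (λ xy≤f → subst (_≤ ∼ x) (unit-left y) (to (residuation x y f) xy≤f))
    (λ y≤∼x → from (residuation x y f) (subst (_≤ ∼ x) (sym (unit-left y)) y≤∼x))
    where
    unit-left : ∀ y → ∼ f · y ≡ y
    unit-left y = trans (cong (_· y) ∼f≡e) (·-identityˡ y)

  ∼x·x≤f : ∀ x → ∼ x · x ≤ f
  ∼x·x≤f x = from (·≤f⇔≤∼ (∼ x) x) (≤-reflexive (sym (¬¬-involutive x)))

  -- (i) ⇒ (ii), in fact from the weaker f² ≤ f: residuate f · f ≤ f.
  f²≤f⇒f≤e : f ² ≤ f → f ≤ e
  f²≤f⇒f≤e f²≤f = subst (f ≤_) ∼f≡e (to (·≤f⇔≤∼ f f) f²≤f)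

  -- If f ≤ e then x² ≤ ∼((∼x)²) for every x, in any IRL: x² and (∼x)² are
  -- orthogonal since their product is (∼x · x)² ≤ f · f ≤ f · e = f.
  f≤e⇒x²≤∼[∼x]² : f ≤ e → ∀ x → x ² ≤ ∼ ((∼ x) ²)
  f≤e⇒x²≤∼[∼x]² f≤e x = to (·≤f⇔≤∼ ((∼ x) ²) (x ²)) (begin
    (∼ x) ² · x ²  ≡⟨ ²-distrib-· (∼ x) x ⟩
    (∼ x · x) ²    ≤⟨ ·-mono (∼x·x≤f x) (∼x·x≤f x) ⟩
    f · f          ≤⟨ ·-mono (≤-refl {f}) f≤e ⟩
    f · e          ≡⟨ ·-identityʳ f ⟩
    f              ∎)

  -- (ii) ⇒ (iii) for square-increasing algebras: x ≤ x² ≤ ∼((∼x)²) ≤ x.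
  f≤e⇒idempotent : SquareIncreasing A → f ≤ e → Idempotent A
  f≤e⇒idempotent square-increasing f≤e x =
    ≤-antisym x²≤x (square-increasing x)
    where
    x²≤x : x ² ≤ x
    x²≤x = begin
      x ²            ≤⟨ f≤e⇒x²≤∼[∼x]² f≤e x ⟩
      ∼ ((∼ x) ²)    ≤⟨ ∼-antitone (square-increasing (∼ x)) ⟩
      ∼ (∼ x)        ≡⟨ ¬¬-involutive x ⟩
      x              ∎

  f∈subalgebra : ∀ {ℓ} (S : Subalgebra A ℓ) → Subalgebra.member S f
  f∈subalgebra S = Subalgebra.¬-closed S (Subalgebra.e-closed S)

theorem3p3 : ∀ {a ℓ} (A : IRL a) → SquareIncreasing A →
    let open IRL A renaming (¬_ to ∼_) in
    ((f ² ≡ f) ⇔ (f ≤ e)) × ((f ≤ e) ⇔ Idempotent A) ×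
    (¬ Idempotent A → (S : Subalgebra A ℓ) → ¬ IdempotentSub A S × ¬ TrivialSub A S)
theorem3p3 A square-increasing =
  mk⇔ i⇒ii (λ f≤e → ii⇒iii f≤e f) ,
  mk⇔ ii⇒iii (λ idempotent → i⇒ii (idempotent f)) ,
  λ not-idempotent S →
    (λ idempotent-S → not-idempotent (ii⇒iii (i⇒ii (idempotent-S f (f∈subalgebra S))))) ,
    (λ trivial-S → not-idempotent (ii⇒iii
      (≤-reflexive (trivial-S f e (f∈subalgebra S) (Subalgebra.e-closed S)))))
  where
  open IRL A renaming (¬_ to ∼_)
  open IRLProperties A

  i⇒ii : f ² ≡ f → f ≤ e
  i⇒ii f²≡f = f²≤f⇒f≤e (≤-reflexive f²≡f)

  ii⇒iii : f ≤ e → Idempotent A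
  ii⇒iii = f≤e⇒idempotent square-increasing
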